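{- Let $G_1$ and $G_2$ be vertex-disjoint connected $4$-regular graphs such that exactly one of $G_1,G_2$ is $(3,1)$-colorable. Then for any $e_1\in E(G_1)$ and $e_2\in E(G_2)$, the graph $(G_1,e_1)+(G_2,e_2)$ is $(3,1)$-colorable.
   Context: All graphs are finite, undirected pseudographs (multiple edges and loops allowed; a loop contributes $2$ to the degree). A $(3,1)$-coloring of a $4$-regular graph is an edge-coloring using at least two colors such that every vertex is incident to exactly $3$ edges of one color and exactly $1$ edge of a different color. Edge adhesion: for vertex-disjoint graphs $G_1,G_2$ and edges $e_1=u_1v_1\in E(G_1)$, $e_2=u_2v_2\in E(G_2)$, the graph $(G_1,e_1)+(G_2,e_2)$ has vertex set $V(G_1)\cup V(G_2)\cup\{w\}$ ($w$ new) and edge set $(E(G_1)\setminus\{e_1\})\cup(E(G_2)\setminus\{e_2\})\cup\{u_1w,v_1w,u_2w,v_2w\}$. -}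

module Defs where

open import Data.Nat using (ℕ; zero; suc; _+_)
open import Data.Nat.Properties using () renaming (_≟_ to _≟ℕ_)
open import Data.Fin using (Fin; zero; suc; _↑ˡ_; _↑ʳ_; splitAt) renaming (_≟_ to _≟F_)
open import Data.List using (map; allFin)
open import Data.Nat.ListAction using (sum)
open import Data.Product using (_×_; _,_; proj₁; proj₂; Σ; ∃; ∃-syntax)
open import Data.Sum using (_⊎_; inj₁; inj₂)
open import Data.Bool using (if_then_else_)
open import Relation.Nullary using (¬_)
open import Relation.Nullary.Decidable using (⌊_⌋)
open import Relation.Binary.PropositionalEquality using (_≡_; _≢_)
open import Relation.Binary.Construct.Closure.ReflexiveTransitive using (Star)

-- A finite pseudograph with vertex set Fin n and edge set Fin m.
-- Each edge has an (unordered, but stored as a pair) pair of endpoints;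
-- loops (both ends equal) and parallel edges are allowed.
record Graph (n m : ℕ) : Set where
  constructor graph
  field
    ends : Fin m → Fin n × Fin n
open Graph public

-- number of ends of an edge (x , y) lying at v (a loop at v counts 2)
inc : {n : ℕ} → Fin n → Fin n × Fin n → ℕ
inc v (x , y) = (if ⌊ x ≟F v ⌋ then 1 else 0) + (if ⌊ y ≟F v ⌋ then 1 else 0)

degree : {n m : ℕ} → Graph n m → Fin n → ℕ
degree {m = m} G v = sum (map (λ e → inc v (ends G e)) (allFin m))

FourRegular : {n m : ℕ} → Graph n m → Set
FourRegular G = ∀ v → degree G v ≡ 4

Adj : {n m : ℕ} → Graph n m → Fin n → Fin n → Set
Adj {m = m} G v w = ∃[ e ] (ends G e ≡ (v , w) ⊎ ends G e ≡ (w , v))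

Connected : {n m : ℕ} → Graph n m → Set
Connected G = ∀ v w → Star (Adj G) v w

colDegree : {n m : ℕ} → Graph n m → (Fin m → ℕ) → ℕ → Fin n → ℕ
colDegree {m = m} G c a v =
  sum (map (λ e → if ⌊ c e ≟ℕ a ⌋ then inc v (ends G e) else 0) (allFin m))

Is31Coloring : {n m : ℕ} → Graph n m → (Fin m → ℕ) → Set
Is31Coloring {m = m} G c =
  (∃[ e ] ∃[ f ] (c e ≢ c f)) ×
  (∀ v → ∃[ a ] ∃[ b ] (a ≢ b × colDegree G c a v ≡ 3 × colDegree G c b v ≡ 1))

Colorable31 : {n m : ℕ} → Graph n m → Set
Colorable31 {m = m} G = ∃[ c ] Is31Coloring {m = m} G c

-- Vertices: zero is the new vertex w,
-- suc (x ↑ˡ n₂) is x ∈ V(G₁), suc (n₁ ↑ʳ y) is y ∈ V(G₂).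
-- Edges (m₁ + m₂ + 2 of them): edge i of G₁ (i ≠ e₁) is kept, slot e₁ now
-- holds u₁w; similarly for G₂ with slot e₂ holding u₂w; the two extra
-- edges are v₁w and v₂w.  Here ends e₁ = (u₁ , v₁), ends e₂ = (u₂ , v₂).
adhesion : {n₁ m₁ n₂ m₂ : ℕ} → Graph n₁ m₁ → Fin m₁ → Graph n₂ m₂ → Fin m₂ →
           Graph (suc (n₁ + n₂)) ((m₁ + m₂) + 2)
adhesion {n₁} {m₁} {n₂} {m₂} G₁ e₁ G₂ e₂ = graph E
  where
  L : Fin n₁ → Fin (suc (n₁ + n₂))
  L x = suc (x ↑ˡ n₂)
  R : Fin n₂ → Fin (suc (n₁ + n₂))
  R y = suc (n₁ ↑ʳ y)
  w : Fin (suc (n₁ + n₂))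
  w = zero
  L² : Fin n₁ × Fin n₁ → Fin (suc (n₁ + n₂)) × Fin (suc (n₁ + n₂))
  L² (x , y) = L x , L y
  R² : Fin n₂ × Fin n₂ → Fin (suc (n₁ + n₂)) × Fin (suc (n₁ + n₂))
  R² (x , y) = R x , R y
  E₁ : Fin m₁ → Fin (suc (n₁ + n₂)) × Fin (suc (n₁ + n₂))
  E₁ i = if ⌊ i ≟F e₁ ⌋ then (L (proj₁ (ends G₁ e₁)) , w) else L² (ends G₁ i)
  E₂ : Fin m₂ → Fin (suc (n₁ + n₂)) × Fin (suc (n₁ + n₂))
  E₂ i = if ⌊ i ≟F e₂ ⌋ then (R (proj₁ (ends G₂ e₂)) , w) else R² (ends G₂ i)
  Ex : Fin 2 → Fin (suc (n₁ + n₂)) × Fin (suc (n₁ + n₂))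
  Ex zero = L (proj₂ (ends G₁ e₁)) , w
  Ex (suc _) = R (proj₂ (ends G₂ e₂)) , w
  E : Fin ((m₁ + m₂) + 2) → Fin (suc (n₁ + n₂)) × Fin (suc (n₁ + n₂))
  E i with splitAt (m₁ + m₂) i
  ... | inj₂ j = Ex j
  ... | inj₁ j with splitAt m₁ j
  ...   | inj₁ a = E₁ a
  ...   | inj₂ b = E₂ b

-- In a connected graph the mod-2 sum of walks from a root r to every vertex is an edge set F in which
-- every vertex has odd degree, except r when the order is odd. In a 4-regular graph odd degree means 1
-- or 3, so painting F and its complement with two colours is a (3,1)-colouring: the uncolourable side,
-- say G₂, has odd order. Root F at the end v₂ of e₂ and paint F with k + 1 and the rest with k, where k
-- is the colour of e₁ in G₁; giving the new edge v₂w the colour opposite to u₂w changes the parity at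
-- v₂ only, so every vertex of G₂ ends up odd. G₁ keeps its colouring, with u₁w and v₁w both coloured k,
-- and the new vertex w sees k three times and k + 1 once.
module Submission where

open import Defs
open import Level using (0ℓ)
open import Algebra.Bundles using (CommutativeMonoid; CommutativeRing; Semiring)
open import Data.Bool using (Bool; true; false; not; _xor_; _∧_; if_then_else_)
open import Data.Bool.Properties
  using (if-float; xor-∧-commutativeRing; not-distribˡ-xor; xor-same; xor-comm; xor-assoc; ∧-distribʳ-xor)
open import Data.Empty using (⊥-elim)
open import Data.Fin using (Fin; zero; suc; _↑ˡ_; _↑ʳ_; splitAt; punchIn) renaming (_≟_ to _≟F_)
open import Data.Fin.Properties
  using (punchInᵢ≢i; suc-injective; ↑ˡ-injective; ↑ʳ-injective; splitAt-↑ˡ; splitAt-↑ʳ; splitAt⁻¹-↑ˡ; splitAt⁻¹-↑ʳ)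
open import Data.List using (map; allFin; tabulate)
open import Data.List.Properties using (map-tabulate; map-cong)
open import Data.Nat using (ℕ; zero; suc; _+_)
import Data.Nat.ListAction as List
open import Data.Nat.Properties
  using (+-*-semiring; +-comm; +-assoc; +-identityʳ; +-cancelʳ-≡; 1+n≢n) renaming (_≟_ to _≟ℕ_)
open import Data.Nat.Tactic.RingSolver using (solve-∀)
open import Data.Product using (_×_; _,_; proj₁; proj₂; ∃-syntax)
import Data.Product as Product
open import Data.Sum using (_⊎_; inj₁; inj₂)
open import Data.Vec.Functional using (removeAt; replicate; _∷_)
open import Function using (id; _∘_; case_of_)
open import Function.Definitions using (Injective)
open import Relation.Binary.Construct.Closure.ReflexiveTransitive using (Star; ε; _◅_)
open import Relation.Binary.PropositionalEquality
  using (_≡_; _≢_; refl; sym; trans; cong; cong₂; subst; _≗_; module ≡-Reasoning)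
open import Relation.Nullary using (¬_; Dec; yes; no)
open import Relation.Nullary.Decidable using (⌊_⌋; isYes≗does; dec-true; dec-false)

-- Finite sums

module FinSum (M : CommutativeMonoid 0ℓ 0ℓ) where
  open CommutativeMonoid M
    using (Carrier; _≈_; setoid; commutativeSemigroup; ∙-cong; ∙-congˡ; ∙-congʳ; identityˡ; identityʳ; assoc)
    renaming (_∙_ to _+ₘ_; ε to 0#; sym to ≈-sym; trans to ≈-trans)
  open import Algebra.Properties.CommutativeMonoid.Sum M
  open import Algebra.Properties.CommutativeSemigroup commutativeSemigroup using (xy∙z≈xz∙y)
  open import Relation.Binary.Reasoning.Setoid setoid

  sum-single : ∀ {m} (f : Fin m → Carrier) (e : Fin m) → (∀ i → i ≢ e → f i ≈ 0#) → sum f ≈ f e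
  sum-single {suc m} f e f≈0 = begin
    sum f                       ≈⟨ sum-remove f ⟩
    f e +ₘ sum (removeAt f e)   ≈⟨ ∙-congˡ (sum-cong-≋ (λ j → f≈0 (punchIn e j) (punchInᵢ≢i e j))) ⟩
    f e +ₘ sum (replicate m 0#) ≈⟨ ∙-congˡ (sum-replicate-zero m) ⟩
    f e +ₘ 0#                   ≈⟨ identityʳ (f e) ⟩
    f e                         ∎

  sum-adjust : ∀ {m} (f g : Fin m → Carrier) (e : Fin m) {d : Carrier} →
               (∀ i → i ≢ e → f i ≈ g i) → f e +ₘ d ≈ g e → sum f +ₘ d ≈ sum g
  sum-adjust {suc m} f g e {d} f≈g fe+d≈ge = begin
    sum f +ₘ d                          ≈⟨ ∙-congʳ (sum-remove f) ⟩
    (f e +ₘ sum (removeAt f e)) +ₘ d    ≈⟨ xy∙z≈xz∙y (f e) _ d ⟩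
    (f e +ₘ d) +ₘ sum (removeAt f e)    ≈⟨ ∙-cong fe+d≈ge (sum-cong-≋ (λ j → f≈g (punchIn e j) (punchInᵢ≢i e j))) ⟩
    g e +ₘ sum (removeAt g e)           ≈⟨ ≈-sym (sum-remove g) ⟩
    sum g                               ∎

  sum-split : ∀ m n (f : Fin (m + n) → Carrier) → sum f ≈ sum (λ i → f (i ↑ˡ n)) +ₘ sum (λ j → f (m ↑ʳ j))
  sum-split zero    n f = ≈-sym (identityˡ _)
  sum-split (suc m) n f = ≈-trans (∙-congˡ (sum-split m n (λ i → f (suc i)))) (≈-sym (assoc _ _ _))

open FinSum (Semiring.+-commutativeMonoid +-*-semiring) using ()
  renaming (sum-single to ∑-single; sum-adjust to ∑-adjust; sum-split to ∑-split)
open import Algebra.Properties.Semiring.Sum +-*-semiring using (sum-replicate-zero; sum-cong-≗; ∑-distrib-+)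
  renaming (sum to ∑)

module 𝔹 where
  open import Algebra.Properties.Semiring.Sum (CommutativeRing.semiring xor-∧-commutativeRing) public
    using (sum-cong-≗; ∑-distrib-+; ∑-comm; *-distribʳ-sum)
    renaming (sum to ⨁)
  open FinSum (CommutativeRing.+-commutativeMonoid xor-∧-commutativeRing) public
    using () renaming (sum-single to ⨁-single)
open 𝔹 using (⨁; ⨁-single)

sum-allFin : ∀ {m} (f : Fin m → ℕ) → List.sum (map f (allFin m)) ≡ ∑ f
sum-allFin {m} f = trans (cong List.sum (map-tabulate id f)) (sum-tabulate f)
  where
  sum-tabulate : ∀ {k} (g : Fin k → ℕ) → List.sum (tabulate g) ≡ ∑ g
  sum-tabulate {zero}  g = refl
  sum-tabulate {suc k} g = cong (g zero +_) (sum-tabulate (λ i → g (suc i)))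

-- Colour degrees

isYes-true : ∀ {A : Set} (a? : Dec A) → A → ⌊ a? ⌋ ≡ true
isYes-true a? a = trans (isYes≗does a?) (dec-true a? a)

isYes-false : ∀ {A : Set} (a? : Dec A) → ¬ A → ⌊ a? ⌋ ≡ false
isYes-false a? ¬a = trans (isYes≗does a?) (dec-false a? ¬a)

_==_ : ∀ {n} → Fin n → Fin n → Bool
x == y = ⌊ x ≟F y ⌋

==-injective : ∀ {n n′} {φ : Fin n → Fin n′} → Injective _≡_ _≡_ φ → ∀ x y → (φ x == φ y) ≡ (x == y)
==-injective {φ = φ} inj x y with x ≟F y
... | yes refl = isYes-true (φ x ≟F φ x) refl
... | no x≢y   = isYes-false (φ x ≟F φ y) (x≢y ∘ inj)

𝟙 : Bool → ℕ
𝟙 b = if b then 1 else 0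

-- k edge-ends of colour c, as counted in the colour degree for colour a
tally : ℕ → ℕ → ℕ → ℕ
tally c k a = if ⌊ c ≟ℕ a ⌋ then k else 0

tally-self : ∀ a k → tally a k a ≡ k
tally-self a k rewrite isYes-true (a ≟ℕ a) refl = refl

tally-other : ∀ {c a} k → c ≢ a → tally c k a ≡ 0
tally-other {c} {a} k c≢a rewrite isYes-false (c ≟ℕ a) c≢a = refl

tally-zero : ∀ c a → tally c 0 a ≡ 0
tally-zero c a with ⌊ c ≟ℕ a ⌋
... | true  = refl
... | false = refl

tally-+ : ∀ c k l a → tally c k a + tally c l a ≡ tally c (k + l) a
tally-+ c k l a with ⌊ c ≟ℕ a ⌋
... | true  = refl
... | false = refl

colDegree-∑ : ∀ {n m} (G : Graph n m) c a v → colDegree G c a v ≡ ∑ (λ i → tally (c i) (inc v (ends G i)) a)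
colDegree-∑ {m = m} G c a v = sum-allFin {m} (λ i → tally (c i) (inc v (ends G i)) a)

degree-∑ : ∀ {n m} (G : Graph n m) v → degree G v ≡ ∑ (λ i → inc v (ends G i))
degree-∑ {m = m} G v = sum-allFin {m} (λ i → inc v (ends G i))

odd : ℕ → Bool
odd zero    = false
odd (suc n) = not (odd n)

odd-+ : ∀ k l → odd (k + l) ≡ odd k xor odd l
odd-+ zero    l = refl
odd-+ (suc k) l rewrite odd-+ k l = not-distribˡ-xor (odd k) (odd l)

odd-𝟙 : ∀ b → odd (𝟙 b) ≡ b
odd-𝟙 true  = refl
odd-𝟙 false = refl

odd-if : ∀ β k → odd (if β then k else 0) ≡ β ∧ odd k
odd-if true  k = refl
odd-if false k = refl

odd-inc : ∀ {n} (x : Fin n) p → odd (inc x p) ≡ (proj₁ p == x) xor (proj₂ p == x)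
odd-inc x (y , z) = trans (odd-+ (𝟙 (y == x)) (𝟙 (z == x))) (cong₂ _xor_ (odd-𝟙 (y == x)) (odd-𝟙 (z == x)))

odd-∑ : ∀ {m} (f : Fin m → ℕ) → odd (∑ f) ≡ ⨁ (odd ∘ f)
odd-∑ {zero}  f = refl
odd-∑ {suc m} f = trans (odd-+ (f zero) (∑ (f ∘ suc))) (cong (odd (f zero) xor_) (odd-∑ (f ∘ suc)))

⨁-const : ∀ n b → ⨁ {n} (λ _ → b) ≡ odd n ∧ b
⨁-const zero    b = refl
⨁-const (suc n) b rewrite ⨁-const n b with odd n | b
... | true  | true  = refl
... | true  | false = refl
... | false | true  = refl
... | false | false = refl

Is31Profile : (ℕ → ℕ) → Set
Is31Profile d = ∃[ a ] ∃[ b ] (a ≢ b × d a ≡ 3 × d b ≡ 1)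

Is31Profile-resp : ∀ {d d′} → d ≗ d′ → Is31Profile d → Is31Profile d′
Is31Profile-resp d≗d′ (a , b , a≢b , da , db) = a , b , a≢b , trans (sym (d≗d′ a)) da , trans (sym (d≗d′ b)) db

odd-split-4 : ∀ k l → k + l ≡ 4 → odd k ≡ true → (k ≡ 1 × l ≡ 3) ⊎ (k ≡ 3 × l ≡ 1)
odd-split-4 1 _ refl _ = inj₁ (refl , refl)
odd-split-4 3 _ refl _ = inj₂ (refl , refl)
odd-split-4 0 _ _ ()
odd-split-4 2 _ _ ()
odd-split-4 4 _ _ ()
odd-split-4 (suc (suc (suc (suc (suc _))))) _ () _

Is31Profile-odd : ∀ {p q} (d : ℕ → ℕ) → p ≢ q → d p + d q ≡ 4 → odd (d p) ≡ true → Is31Profile d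
Is31Profile-odd {p} {q} d p≢q sum≡4 odd-dp with odd-split-4 (d p) (d q) sum≡4 odd-dp
... | inj₁ (dp≡1 , dq≡3) = q , p , p≢q ∘ sym , dq≡3 , dp≡1
... | inj₂ (dp≡3 , dq≡1) = p , q , p≢q , dp≡3 , dq≡1

∑-nonzero : ∀ {m} (f : Fin m → ℕ) → ∑ f ≢ 0 → ∃[ i ] f i ≢ 0
∑-nonzero {zero}  f ∑f≢0 = ⊥-elim (∑f≢0 refl)
∑-nonzero {suc m} f ∑f≢0 with f zero in f0≡
... | suc _ = zero , λ f0≡0 → case trans (sym f0≡) f0≡0 of λ ()
... | zero  = Product.map suc id (∑-nonzero (f ∘ suc) ∑f≢0)

tally-nonzero : ∀ c k a → tally c k a ≢ 0 → c ≡ a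
tally-nonzero c k a t≢0 with c ≟ℕ a
... | yes c≡a = c≡a
... | no  _   = ⊥-elim (t≢0 refl)

colDegree-nonzero : ∀ {n m} (G : Graph n m) c a v → colDegree G c a v ≢ 0 → ∃[ i ] c i ≡ a
colDegree-nonzero G c a v deg≢0 =
  Product.map id (λ {i} → tally-nonzero (c i) _ a)
    (∑-nonzero _ (λ ∑≡0 → deg≢0 (trans (colDegree-∑ G c a v) ∑≡0)))

Is31Coloring-from-profiles : ∀ {n m} (G : Graph n m) c → Fin n →
  (∀ v → Is31Profile (λ a → colDegree G c a v)) → Is31Coloring G c
Is31Coloring-from-profiles G c r profile = two-colours (profile r) , profile
  where
  two-colours : Is31Profile (λ a → colDegree G c a r) → ∃[ i ] ∃[ j ] c i ≢ c j
  two-colours (a , b , a≢b , da≡3 , db≡1)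
    with colDegree-nonzero G c a r (λ da≡0 → case trans (sym da≡3) da≡0 of λ ())
       | colDegree-nonzero G c b r (λ db≡0 → case trans (sym db≡1) db≡0 of λ ())
  ... | i , ci≡a | j , cj≡b = i , j , λ ci≡cj → a≢b (trans (sym ci≡a) (trans ci≡cj cj≡b))

paint : ∀ {m} → ℕ → ℕ → (Fin m → Bool) → Fin m → ℕ
paint p q F i = if F i then p else q

degreeIn : ∀ {n m} → Graph n m → (Fin m → Bool) → Fin n → ℕ
degreeIn G F v = ∑ (λ i → if F i then inc v (ends G i) else 0)

tally-paint : ∀ {p q} → p ≢ q → ∀ β k → tally (if β then p else q) k p ≡ (if β then k else 0)
tally-paint {p} p≢q true  k = tally-self p k
tally-paint     p≢q false k = tally-other k (p≢q ∘ sym)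

colDegree-paint : ∀ {n m} (G : Graph n m) {p q} → p ≢ q → ∀ F v → colDegree G (paint p q F) p v ≡ degreeIn G F v
colDegree-paint G p≢q F v =
  trans (colDegree-∑ G _ _ v) (sum-cong-≗ (λ i → tally-paint p≢q (F i) (inc v (ends G i))))

colDegree-paint-sum : ∀ {n m} (G : Graph n m) {p q} → p ≢ q → ∀ F v →
  colDegree G (paint p q F) p v + colDegree G (paint p q F) q v ≡ degree G v
colDegree-paint-sum {m = m} G {p} {q} p≢q F v = begin
  colDegree G (paint p q F) p v + colDegree G (paint p q F) q v
    ≡⟨ cong₂ _+_ (colDegree-∑ G _ p v) (colDegree-∑ G _ q v) ⟩
  ∑ (λ i → tally (paint p q F i) (inc v (ends G i)) p) + ∑ (λ i → tally (paint p q F i) (inc v (ends G i)) q)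
    ≡⟨ sym (∑-distrib-+ {m} _ _) ⟩
  ∑ (λ i → tally (paint p q F i) (inc v (ends G i)) p + tally (paint p q F i) (inc v (ends G i)) q)
    ≡⟨ sum-cong-≗ (λ i → split (F i) (inc v (ends G i))) ⟩
  ∑ (λ i → inc v (ends G i))
    ≡⟨ sym (degree-∑ G v) ⟩
  degree G v ∎
  where
  open ≡-Reasoning
  split : ∀ β k → tally (if β then p else q) k p + tally (if β then p else q) k q ≡ k
  split true  k = trans (cong₂ _+_ (tally-self p k) (tally-other k p≢q)) (+-identityʳ k)
  split false k = cong₂ _+_ (tally-other k (p≢q ∘ sym)) (tally-self q k)

mapVertices : ∀ {n n′ m} → (Fin n → Fin n′) → Graph n m → Graph n′ m
mapVertices φ G = graph (λ i → Product.map φ φ (ends G i))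

inc-mapVertices : ∀ {n n′} {φ : Fin n → Fin n′} → Injective _≡_ _≡_ φ → ∀ v p → inc (φ v) (Product.map φ φ p) ≡ inc v p
inc-mapVertices inj v (x , y) = cong₂ _+_ (cong 𝟙 (==-injective inj x v)) (cong 𝟙 (==-injective inj y v))

module _ {n n′ m} {φ : Fin n → Fin n′} (G : Graph n m) where

  colDegree-mapVertices : Injective _≡_ _≡_ φ → ∀ c a v → colDegree (mapVertices φ G) c a (φ v) ≡ colDegree G c a v
  colDegree-mapVertices inj c a v =
    cong List.sum (map-cong (λ i → cong (λ k → tally (c i) k a) (inc-mapVertices inj v (ends G i))) (allFin m))

  colDegree-mapVertices-outside : ∀ {z} → (∀ x → φ x ≢ z) → ∀ c a → colDegree (mapVertices φ G) c a z ≡ 0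
  colDegree-mapVertices-outside {z} outside c a = begin
    colDegree (mapVertices φ G) c a z                ≡⟨ colDegree-∑ (mapVertices φ G) c a z ⟩
    ∑ (λ i → tally (c i) (inc z (ends (mapVertices φ G) i)) a) ≡⟨ sum-cong-≗ inc-φ ⟩
    ∑ {m} (λ _ → 0)                                  ≡⟨ sum-replicate-zero m ⟩
    0                                                ∎
    where
    open ≡-Reasoning
    miss : ∀ x → 𝟙 (φ x == z) ≡ 0
    miss x = cong 𝟙 (isYes-false (φ x ≟F z) (outside x))
    inc-φ : ∀ i → tally (c i) (inc z (ends (mapVertices φ G) i)) a ≡ 0
    inc-φ i = trans (cong (λ k → tally (c i) k a) (cong₂ _+_ (miss (proj₁ (ends G i))) (miss (proj₂ (ends G i)))))
                    (tally-zero (c i) a)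

-- Subdividing an edge

inc-suc-spoke : ∀ {n} (x y : Fin n) → inc (suc x) (suc y , zero) ≡ 𝟙 (y == x)
inc-suc-spoke x y = trans (+-identityʳ _) (cong 𝟙 (==-injective suc-injective y x))

subdivide : ∀ {n m} → Graph n m → Fin m → Graph (suc n) (suc m)
subdivide G e = graph λ where
  zero    → suc (proj₂ (ends G e)) , zero
  (suc i) → if i == e then (suc (proj₁ (ends G e)) , zero) else Product.map suc suc (ends G i)

module _ {n m} (G : Graph n m) (e : Fin m) where
  private
    u v : Fin n
    u = proj₁ (ends G e)
    v = proj₂ (ends G e)

  ends-subdivide-e : ends (subdivide G e) (suc e) ≡ (suc u , zero)
  ends-subdivide-e rewrite isYes-true (e ≟F e) refl = refl

  ends-subdivide-old : ∀ {i} → i ≢ e → ends (subdivide G e) (suc i) ≡ Product.map suc suc (ends G i)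
  ends-subdivide-old {i} i≢e rewrite isYes-false (i ≟F e) i≢e = refl

  -- On the old vertices, subdividing e only moves the v-end of e onto the new edge.
  colDegree-subdivide-suc : ∀ (col : Fin (suc m) → ℕ) a x →
    colDegree (subdivide G e) col a (suc x) + tally (col (suc e)) (𝟙 (v == x)) a
      ≡ colDegree G (col ∘ suc) a x + tally (col zero) (𝟙 (v == x)) a
  colDegree-subdivide-suc col a x = begin
    colDegree (subdivide G e) col a (suc x) + moved   ≡⟨ cong (_+ moved) (colDegree-∑ (subdivide G e) col a (suc x)) ⟩
    (t zero + ∑ (t ∘ suc)) + moved                    ≡⟨ +-assoc (t zero) (∑ (t ∘ suc)) moved ⟩
    t zero + (∑ (t ∘ suc) + moved)                    ≡⟨ cong₂ _+_ at-spoke (∑-adjust (t ∘ suc) tG e off-e at-e) ⟩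
    spoke + ∑ tG                                      ≡⟨ +-comm spoke (∑ tG) ⟩
    ∑ tG + spoke                                      ≡⟨ cong (_+ spoke) (colDegree-∑ G (col ∘ suc) a x) ⟨
    colDegree G (col ∘ suc) a x + spoke               ∎
    where
    open ≡-Reasoning
    moved spoke : ℕ
    moved = tally (col (suc e)) (𝟙 (v == x)) a
    spoke = tally (col zero) (𝟙 (v == x)) a
    t : Fin (suc m) → ℕ
    t i = tally (col i) (inc (suc x) (ends (subdivide G e) i)) a
    at-spoke : t zero ≡ spoke
    at-spoke = cong (λ k → tally (col zero) k a) (inc-suc-spoke x v)
    tG : Fin m → ℕ
    tG i = tally (col (suc i)) (inc x (ends G i)) a
    off-e : ∀ i → i ≢ e → t (suc i) ≡ tG i
    off-e i i≢e = trans (cong (λ p → tally (col (suc i)) (inc (suc x) p) a) (ends-subdivide-old i≢e))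
                        (cong (λ k → tally (col (suc i)) k a) (inc-mapVertices suc-injective x (ends G i)))
    at-e : t (suc e) + moved ≡ tG e
    at-e = trans (cong (λ p → tally (col (suc e)) (inc (suc x) p) a + moved) ends-subdivide-e)
      (trans (tally-+ (col (suc e)) _ _ a) (cong (λ k → tally (col (suc e)) (k + 𝟙 (v == x)) a) (inc-suc-spoke x u)))

  colDegree-subdivide-zero : ∀ (col : Fin (suc m) → ℕ) a →
    colDegree (subdivide G e) col a zero ≡ tally (col zero) 1 a + tally (col (suc e)) 1 a
  colDegree-subdivide-zero col a =
    trans (colDegree-∑ (subdivide G e) col a zero)
          (cong (tally (col zero) 1 a +_) (trans (∑-single (t ∘ suc) e off-e) at-e))
    where
    t : Fin (suc m) → ℕ
    t i = tally (col i) (inc zero (ends (subdivide G e) i)) a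
    off-e : ∀ i → i ≢ e → t (suc i) ≡ 0
    off-e i i≢e = trans (cong (λ p → tally (col (suc i)) (inc zero p) a) (ends-subdivide-old i≢e))
                        (tally-zero (col (suc i)) a)
    at-e : t (suc e) ≡ tally (col (suc e)) 1 a
    at-e = cong (λ p → tally (col (suc e)) (inc zero p) a) ends-subdivide-e

  degree-subdivide : ∀ x → degree (subdivide G e) (suc x) ≡ degree G x
  degree-subdivide x = +-cancelʳ-≡ _ _ _ (colDegree-subdivide-suc (λ _ → 0) 0 x)

  subdivide-Is31Profile-keep : ∀ c → (∀ x → Is31Profile (λ a → colDegree G c a x)) →
    ∀ x → Is31Profile (λ a → colDegree (subdivide G e) (c e ∷ c) a (suc x))
  subdivide-Is31Profile-keep c profile x =
    Is31Profile-resp (λ a → sym (+-cancelʳ-≡ _ _ _ (colDegree-subdivide-suc (c e ∷ c) a x))) (profile x)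

  subdivide-Is31Profile-paint : ∀ {p q} → p ≢ q → FourRegular G → (F : Fin m → Bool) →
    (∀ x → odd (degreeIn G F x) ≡ not (v == x)) →
    ∀ x → Is31Profile (λ a → colDegree (subdivide G e) (paint p q (not (F e) ∷ F)) a (suc x))
  subdivide-Is31Profile-paint {p} {q} p≢q regular F odd-F x = Is31Profile-odd d p≢q sum≡4 odd-dp
    where
    F′ : Fin (suc m) → Bool
    F′ = not (F e) ∷ F
    d : ℕ → ℕ
    d a = colDegree (subdivide G e) (paint p q F′) a (suc x)
    b : Bool
    b = v == x
    sum≡4 : d p + d q ≡ 4
    sum≡4 = trans (colDegree-paint-sum (subdivide G e) p≢q F′ (suc x)) (trans (degree-subdivide x) (regular x))
    moved : d p + (if F e then 𝟙 b else 0) ≡ degreeIn G F x + (if not (F e) then 𝟙 b else 0)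
    moved = begin
      d p + (if F e then 𝟙 b else 0)                                ≡⟨ cong (d p +_) (tally-paint p≢q (F e) (𝟙 b)) ⟨
      d p + tally (paint p q F′ (suc e)) (𝟙 b) p                    ≡⟨ colDegree-subdivide-suc (paint p q F′) p x ⟩
      colDegree G (paint p q F) p x + tally (paint p q F′ zero) (𝟙 b) p
        ≡⟨ cong₂ _+_ (colDegree-paint G p≢q F x) (tally-paint p≢q (not (F e)) (𝟙 b)) ⟩
      degreeIn G F x + (if not (F e) then 𝟙 b else 0)               ∎
      where open ≡-Reasoning
    moved-parity : ∀ β → odd (if β then 𝟙 b else 0) ≡ β ∧ b
    moved-parity β = trans (odd-if β (𝟙 b)) (cong (β ∧_) (odd-𝟙 b))
    balance : ∀ o β c → o xor (β ∧ c) ≡ not c xor (not β ∧ c) → o ≡ true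
    balance true  _     _     _  = refl
    balance false true  true  ()
    balance false true  false ()
    balance false false true  ()
    balance false false false ()
    odd-dp : odd (d p) ≡ true
    odd-dp = balance (odd (d p)) (F e) b (begin
      odd (d p) xor (F e ∧ b)                                      ≡⟨ cong (odd (d p) xor_) (moved-parity (F e)) ⟨
      odd (d p) xor odd (if F e then 𝟙 b else 0)                   ≡⟨ odd-+ (d p) _ ⟨
      odd (d p + (if F e then 𝟙 b else 0))                         ≡⟨ cong odd moved ⟩
      odd (degreeIn G F x + (if not (F e) then 𝟙 b else 0))        ≡⟨ odd-+ (degreeIn G F x) _ ⟩
      odd (degreeIn G F x) xor odd (if not (F e) then 𝟙 b else 0)  ≡⟨ cong₂ _xor_ (odd-F x) (moved-parity (not (F e))) ⟩
      not b xor (not (F e) ∧ b)                                    ∎)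
      where open ≡-Reasoning

-- Parity subgraphs

module _ {n m} (G : Graph n m) where

  odd-degreeIn : ∀ F x → odd (degreeIn G F x) ≡ ⨁ (λ i → F i ∧ odd (inc x (ends G i)))
  odd-degreeIn F x = trans (odd-∑ {m} _) (𝔹.sum-cong-≗ {m} (λ i → odd-if (F i) (inc x (ends G i))))

  walkEdges : ∀ {s t} → Star (Adj G) s t → Fin m → Bool
  walkEdges ε             i = false
  walkEdges ((e , _) ◅ w) i = (i == e) xor walkEdges w i

  odd-degreeIn-walk : ∀ {s t} (w : Star (Adj G) s t) x → odd (degreeIn G (walkEdges w) x) ≡ (s == x) xor (t == x)
  odd-degreeIn-walk {s} ε x = trans (cong odd (sum-replicate-zero m)) (sym (xor-same (s == x)))
  odd-degreeIn-walk {s} {t} (_◅_ {j = u} (e , e-joins) w) x = begin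
    odd (degreeIn G (walkEdges ((e , e-joins) ◅ w)) x)
      ≡⟨ odd-degreeIn _ x ⟩
    ⨁ (λ i → ((i == e) xor walkEdges w i) ∧ o i)
      ≡⟨ 𝔹.sum-cong-≗ (λ i → ∧-distribʳ-xor (o i) (i == e) (walkEdges w i)) ⟩
    ⨁ (λ i → ((i == e) ∧ o i) xor (walkEdges w i ∧ o i))
      ≡⟨ 𝔹.∑-distrib-+ (λ i → (i == e) ∧ o i) (λ i → walkEdges w i ∧ o i) ⟩
    ⨁ (λ i → (i == e) ∧ o i) xor ⨁ (λ i → walkEdges w i ∧ o i)
      ≡⟨ cong₂ _xor_ (⨁-single _ e off-e) (sym (odd-degreeIn (walkEdges w) x)) ⟩
    ((e == e) ∧ o e) xor odd (degreeIn G (walkEdges w) x)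
      ≡⟨ cong₂ _xor_ (cong (_∧ o e) (isYes-true (e ≟F e) refl)) (odd-degreeIn-walk w x) ⟩
    o e xor ((u == x) xor (t == x))
      ≡⟨ cong (_xor ((u == x) xor (t == x))) (odd-joining e-joins) ⟩
    ((s == x) xor (u == x)) xor ((u == x) xor (t == x))
      ≡⟨ xor-telescope (s == x) (u == x) (t == x) ⟩
    (s == x) xor (t == x) ∎
    where
    open ≡-Reasoning
    o : Fin m → Bool
    o i = odd (inc x (ends G i))
    off-e : ∀ i → i ≢ e → ((i == e) ∧ o i) ≡ false
    off-e i i≢e = cong (_∧ o i) (isYes-false (i ≟F e) i≢e)
    odd-joining : ends G e ≡ (s , u) ⊎ ends G e ≡ (u , s) → o e ≡ (s == x) xor (u == x)
    odd-joining (inj₁ ends≡) = trans (cong (odd ∘ inc x) ends≡) (odd-inc x (s , u))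
    odd-joining (inj₂ ends≡) = trans (cong (odd ∘ inc x) ends≡) (trans (odd-inc x (u , s)) (xor-comm (u == x) (s == x)))
    xor-telescope : ∀ a b c → (a xor b) xor (b xor c) ≡ a xor c
    xor-telescope a b c = begin
      (a xor b) xor (b xor c)   ≡⟨ xor-assoc a b (b xor c) ⟩
      a xor (b xor (b xor c))   ≡⟨ cong (a xor_) (xor-assoc b b c) ⟨
      a xor ((b xor b) xor c)   ≡⟨ cong (λ z → a xor (z xor c)) (xor-same b) ⟩
      a xor c                   ∎

  parity-subgraph : Connected G → (r : Fin n) → ∃[ F ] ∀ x → odd (degreeIn G F x) ≡ not (odd n ∧ (r == x))
  parity-subgraph connected r = F , parity
    where
    W : Fin n → Fin m → Bool
    W y = walkEdges (connected r y)
    F : Fin m → Bool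
    F i = ⨁ (λ y → W y i)
    parity : ∀ x → odd (degreeIn G F x) ≡ not (odd n ∧ (r == x))
    parity x = begin
      odd (degreeIn G F x)                        ≡⟨ odd-degreeIn F x ⟩
      ⨁ (λ i → ⨁ (λ y → W y i) ∧ o i)             ≡⟨ 𝔹.sum-cong-≗ (λ i → 𝔹.*-distribʳ-sum (o i) (λ y → W y i)) ⟩
      ⨁ (λ i → ⨁ (λ y → W y i ∧ o i))             ≡⟨ 𝔹.∑-comm (λ i y → W y i ∧ o i) ⟩
      ⨁ (λ y → ⨁ (λ i → W y i ∧ o i))             ≡⟨ 𝔹.sum-cong-≗ walk-parity ⟩
      ⨁ (λ y → (r == x) xor (y == x))             ≡⟨ 𝔹.∑-distrib-+ {n} (λ _ → r == x) (λ y → y == x) ⟩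
      ⨁ {n} (λ _ → r == x) xor ⨁ (λ y → y == x)   ≡⟨ cong₂ _xor_ (⨁-const n (r == x)) (⨁-single _ x off-x) ⟩
      (odd n ∧ (r == x)) xor (x == x)             ≡⟨ cong ((odd n ∧ (r == x)) xor_) (isYes-true (x ≟F x) refl) ⟩
      (odd n ∧ (r == x)) xor true                 ≡⟨ xor-comm (odd n ∧ (r == x)) true ⟩
      not (odd n ∧ (r == x))                      ∎
      where
      open ≡-Reasoning
      o : Fin m → Bool
      o i = odd (inc x (ends G i))
      walk-parity : ∀ y → ⨁ (λ i → W y i ∧ o i) ≡ (r == x) xor (y == x)
      walk-parity y = trans (sym (odd-degreeIn (W y) x)) (odd-degreeIn-walk (connected r y) x)
      off-x : ∀ y → y ≢ x → (y == x) ≡ false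
      off-x y y≢x = isYes-false (y ≟F x) y≢x

  Colorable31-even : Connected G → FourRegular G → odd n ≡ false → Fin n → Colorable31 G
  Colorable31-even connected regular even r with parity-subgraph connected r
  ... | F , odd-F = paint 1 0 F , Is31Coloring-from-profiles G (paint 1 0 F) r profile
    where
    profile : ∀ x → Is31Profile (λ a → colDegree G (paint 1 0 F) a x)
    profile x = Is31Profile-odd _ (λ ()) (trans (colDegree-paint-sum G (λ ()) F x) (regular x))
      (trans (cong odd (colDegree-paint G (λ ()) F x)) (trans (odd-F x) (cong (λ o → not (o ∧ (r == x))) even)))

  ¬Colorable31⇒odd : Connected G → FourRegular G → ¬ Colorable31 G → Fin m → odd n ≡ true
  ¬Colorable31⇒odd connected regular uncolourable e with odd n in parity
  ... | true  = refl
  ... | false = ⊥-elim (uncolourable (Colorable31-even connected regular parity (proj₁ (ends G e))))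

  subdivide-recolour : Connected G → FourRegular G → odd n ≡ true → (e : Fin m) → ∀ {p q} → p ≢ q →
    ∃[ col ] (∀ x → Is31Profile (λ a → colDegree (subdivide G e) col a (suc x)))
           × (∀ a → colDegree (subdivide G e) col a zero ≡ tally q 1 a + tally p 1 a)
  subdivide-recolour connected regular odd-n e {p} {q} p≢q with parity-subgraph connected (proj₂ (ends G e))
  ... | F , odd-F = paint p q (not (F e) ∷ F)
                  , subdivide-Is31Profile-paint G e p≢q regular F
                      (λ x → trans (odd-F x) (cong (λ o → not (o ∧ (proj₂ (ends G e) == x))) odd-n))
                  , λ a → trans (colDegree-subdivide-zero G e _ a) (spokes (F e) a)
    where
    spokes : ∀ β a → tally (if not β then p else q) 1 a + tally (if β then p else q) 1 a ≡ tally q 1 a + tally p 1 a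
    spokes true  a = refl
    spokes false a = +-comm (tally p 1 a) (tally q 1 a)

-- Edge adhesion

Is31Profile-spokes : ∀ k → Is31Profile (λ a → (tally k 1 a + tally k 1 a) + (tally k 1 a + tally (suc k) 1 a))
Is31Profile-spokes k = k , suc k , 1+n≢n ∘ sym , at-k , at-suc-k
  where
  at-k : (tally k 1 k + tally k 1 k) + (tally k 1 k + tally (suc k) 1 k) ≡ 3
  at-k rewrite tally-self k 1 | tally-other {suc k} 1 1+n≢n = refl
  at-suc-k : (tally k 1 (suc k) + tally k 1 (suc k)) + (tally k 1 (suc k) + tally (suc k) 1 (suc k)) ≡ 1
  at-suc-k rewrite tally-other {k} 1 (1+n≢n ∘ sym) | tally-self (suc k) 1 = refl

module _ {n₁ m₁ n₂ m₂} (G₁ : Graph n₁ m₁) (e₁ : Fin m₁) (G₂ : Graph n₂ m₂) (e₂ : Fin m₂) where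
  private
    H : Graph (suc (n₁ + n₂)) ((m₁ + m₂) + 2)
    H = adhesion G₁ e₁ G₂ e₂

  -- The adhesion is the union of the two subdivisions, glued at their new vertices (w = zero).
  left : Fin (suc n₁) → Fin (suc (n₁ + n₂))
  left zero    = zero
  left (suc x) = suc (x ↑ˡ n₂)

  right : Fin (suc n₂) → Fin (suc (n₁ + n₂))
  right zero    = zero
  right (suc y) = suc (n₁ ↑ʳ y)

  left-injective : Injective _≡_ _≡_ left
  left-injective {zero}  {zero}  _ = refl
  left-injective {suc x} {suc y} eq = cong suc (↑ˡ-injective n₂ x y (suc-injective eq))

  right-injective : Injective _≡_ _≡_ right
  right-injective {zero}  {zero}  _ = refl
  right-injective {suc x} {suc y} eq = cong suc (↑ʳ-injective n₁ x y (suc-injective eq))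

  ↑ˡ≢↑ʳ : ∀ x y → x ↑ˡ n₂ ≢ n₁ ↑ʳ y
  ↑ˡ≢↑ʳ x y eq with trans (sym (splitAt-↑ˡ n₁ x n₂)) (trans (cong (splitAt n₁) eq) (splitAt-↑ʳ n₁ n₂ y))
  ... | ()

  right≢left-suc : ∀ x p → right p ≢ left (suc x)
  right≢left-suc x (suc y) eq = ↑ˡ≢↑ʳ x y (sym (suc-injective eq))

  left≢right-suc : ∀ y p → left p ≢ right (suc y)
  left≢right-suc y (suc x) eq = ↑ˡ≢↑ʳ x y (suc-injective eq)

  glue : (Fin (suc m₁) → ℕ) → (Fin (suc m₂) → ℕ) → Fin ((m₁ + m₂) + 2) → ℕ
  glue col₁ col₂ i with splitAt (m₁ + m₂) i
  ... | inj₂ zero       = col₁ zero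
  ... | inj₂ (suc zero) = col₂ zero
  ... | inj₁ j with splitAt m₁ j
  ...   | inj₁ i₁ = col₁ (suc i₁)
  ...   | inj₂ i₂ = col₂ (suc i₂)

  private
    H₁ : Graph (suc (n₁ + n₂)) (suc m₁)
    H₁ = mapVertices left (subdivide G₁ e₁)
    H₂ : Graph (suc (n₁ + n₂)) (suc m₂)
    H₂ = mapVertices right (subdivide G₂ e₂)

  colDegree-adhesion : ∀ col₁ col₂ a z →
    colDegree H (glue col₁ col₂) a z ≡ colDegree H₁ col₁ a z + colDegree H₂ col₂ a z
  colDegree-adhesion col₁ col₂ a z = begin
    colDegree H (glue col₁ col₂) a z
      ≡⟨ colDegree-∑ H (glue col₁ col₂) a z ⟩
    ∑ t
      ≡⟨ ∑-split (m₁ + m₂) 2 t ⟩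
    ∑ (λ j → t (j ↑ˡ 2)) + spokes
      ≡⟨ cong (_+ spokes) (∑-split m₁ m₂ (λ j → t (j ↑ˡ 2))) ⟩
    (∑ (λ i → t ((i ↑ˡ m₂) ↑ˡ 2)) + ∑ (λ i → t ((m₁ ↑ʳ i) ↑ˡ 2))) + spokes
      ≡⟨ cong₂ _+_ (cong₂ _+_ (sum-cong-≗ t-left) (sum-cong-≗ t-right)) (cong₂ _+_ t-spoke₁ (cong (_+ 0) t-spoke₂)) ⟩
    (∑ (t₁ ∘ suc) + ∑ (t₂ ∘ suc)) + (t₁ zero + (t₂ zero + 0))
      ≡⟨ rearrange (∑ (t₁ ∘ suc)) (∑ (t₂ ∘ suc)) (t₁ zero) (t₂ zero) ⟩
    (t₁ zero + ∑ (t₁ ∘ suc)) + (t₂ zero + ∑ (t₂ ∘ suc))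
      ≡⟨ cong₂ _+_ (colDegree-∑ H₁ col₁ a z) (colDegree-∑ H₂ col₂ a z) ⟨
    colDegree H₁ col₁ a z + colDegree H₂ col₂ a z ∎
    where
    open ≡-Reasoning
    t : Fin ((m₁ + m₂) + 2) → ℕ
    t i = tally (glue col₁ col₂ i) (inc z (ends H i)) a
    spokes : ℕ
    spokes = t ((m₁ + m₂) ↑ʳ zero) + (t ((m₁ + m₂) ↑ʳ suc zero) + 0)
    t₁ : Fin (suc m₁) → ℕ
    t₁ i = tally (col₁ i) (inc z (ends H₁ i)) a
    t₂ : Fin (suc m₂) → ℕ
    t₂ i = tally (col₂ i) (inc z (ends H₂ i)) a
    t-left : ∀ i → t ((i ↑ˡ m₂) ↑ˡ 2) ≡ t₁ (suc i)
    t-left i rewrite splitAt-↑ˡ (m₁ + m₂) (i ↑ˡ m₂) 2 | splitAt-↑ˡ m₁ i m₂ =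
      cong (λ p → tally (col₁ (suc i)) (inc z p) a) (sym (if-float (Product.map left left) (i == e₁)))
    t-right : ∀ i → t ((m₁ ↑ʳ i) ↑ˡ 2) ≡ t₂ (suc i)
    t-right i rewrite splitAt-↑ˡ (m₁ + m₂) (m₁ ↑ʳ i) 2 | splitAt-↑ʳ m₁ m₂ i =
      cong (λ p → tally (col₂ (suc i)) (inc z p) a) (sym (if-float (Product.map right right) (i == e₂)))
    t-spoke₁ : t ((m₁ + m₂) ↑ʳ zero) ≡ t₁ zero
    t-spoke₁ rewrite splitAt-↑ʳ (m₁ + m₂) 2 zero = refl
    t-spoke₂ : t ((m₁ + m₂) ↑ʳ suc zero) ≡ t₂ zero
    t-spoke₂ rewrite splitAt-↑ʳ (m₁ + m₂) 2 (suc zero) = refl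
    rearrange : ∀ s₁ s₂ w₁ w₂ → (s₁ + s₂) + (w₁ + (w₂ + 0)) ≡ (w₁ + s₁) + (w₂ + s₂)
    rearrange = solve-∀

  data AdhesionVertex : Fin (suc (n₁ + n₂)) → Set where
    new  : AdhesionVertex zero
    old₁ : ∀ x → AdhesionVertex (left (suc x))
    old₂ : ∀ y → AdhesionVertex (right (suc y))

  adhesionVertex : ∀ z → AdhesionVertex z
  adhesionVertex zero = new
  adhesionVertex (suc j) with splitAt n₁ j in eq
  ... | inj₁ x = subst (AdhesionVertex ∘ suc) (splitAt⁻¹-↑ˡ eq) (old₁ x)
  ... | inj₂ y = subst (AdhesionVertex ∘ suc) (splitAt⁻¹-↑ʳ eq) (old₂ y)

  Is31Coloring-adhesion : ∀ col₁ col₂ →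
    (∀ x → Is31Profile (λ a → colDegree (subdivide G₁ e₁) col₁ a (suc x))) →
    (∀ y → Is31Profile (λ a → colDegree (subdivide G₂ e₂) col₂ a (suc y))) →
    Is31Profile (λ a → colDegree (subdivide G₁ e₁) col₁ a zero + colDegree (subdivide G₂ e₂) col₂ a zero) →
    Is31Coloring H (glue col₁ col₂)
  Is31Coloring-adhesion col₁ col₂ profile₁ profile₂ profile-w =
    Is31Coloring-from-profiles H (glue col₁ col₂) zero (λ z → profile z (adhesionVertex z))
    where
    degree₁ : ∀ a x → colDegree H₁ col₁ a (left x) ≡ colDegree (subdivide G₁ e₁) col₁ a x
    degree₁ a x = colDegree-mapVertices (subdivide G₁ e₁) left-injective col₁ a x
    degree₂ : ∀ a y → colDegree H₂ col₂ a (right y) ≡ colDegree (subdivide G₂ e₂) col₂ a y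
    degree₂ a y = colDegree-mapVertices (subdivide G₂ e₂) right-injective col₂ a y
    profile : ∀ z → AdhesionVertex z → Is31Profile (λ a → colDegree H (glue col₁ col₂) a z)
    profile _ new = Is31Profile-resp
      (λ a → sym (trans (colDegree-adhesion col₁ col₂ a zero) (cong₂ _+_ (degree₁ a zero) (degree₂ a zero))))
      profile-w
    profile _ (old₁ x) = Is31Profile-resp
      (λ a → sym (trans (colDegree-adhesion col₁ col₂ a (left (suc x)))
        (trans (cong₂ _+_ (degree₁ a (suc x)) (colDegree-mapVertices-outside (subdivide G₂ e₂) (right≢left-suc x) col₂ a))
               (+-identityʳ _))))
      (profile₁ x)
    profile _ (old₂ y) = Is31Profile-resp
      (λ a → sym (trans (colDegree-adhesion col₁ col₂ a (right (suc y)))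
        (cong₂ _+_ (colDegree-mapVertices-outside (subdivide G₁ e₁) (left≢right-suc y) col₁ a) (degree₂ a (suc y)))))
      (profile₂ y)

  Colorable31-adhesionˡ : ∀ c₁ → Is31Coloring G₁ c₁ →
    Connected G₂ → FourRegular G₂ → odd n₂ ≡ true → Colorable31 H
  Colorable31-adhesionˡ c₁ (_ , profile₁) connected₂ regular₂ odd₂
    with subdivide-recolour G₂ connected₂ regular₂ odd₂ e₂ {suc (c₁ e₁)} 1+n≢n
  ... | col₂ , profile₂ , spokes₂ =
    glue col₁ col₂ , Is31Coloring-adhesion col₁ col₂ (subdivide-Is31Profile-keep G₁ e₁ c₁ profile₁) profile₂
      (Is31Profile-resp (λ a → sym (cong₂ _+_ (colDegree-subdivide-zero G₁ e₁ col₁ a) (spokes₂ a)))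
        (Is31Profile-spokes (c₁ e₁)))
    where
    col₁ : Fin (suc m₁) → ℕ
    col₁ = c₁ e₁ ∷ c₁

  Colorable31-adhesionʳ : Connected G₁ → FourRegular G₁ → odd n₁ ≡ true →
    ∀ c₂ → Is31Coloring G₂ c₂ → Colorable31 H
  Colorable31-adhesionʳ connected₁ regular₁ odd₁ c₂ (_ , profile₂)
    with subdivide-recolour G₁ connected₁ regular₁ odd₁ e₁ {suc (c₂ e₂)} 1+n≢n
  ... | col₁ , profile₁ , spokes₁ =
    glue col₁ col₂ , Is31Coloring-adhesion col₁ col₂ profile₁ (subdivide-Is31Profile-keep G₂ e₂ c₂ profile₂)
      (Is31Profile-resp (λ a → sym (trans (cong₂ _+_ (spokes₁ a) (colDegree-subdivide-zero G₂ e₂ col₂ a))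
                                          (+-comm (tally k 1 a + tally (suc k) 1 a) (tally k 1 a + tally k 1 a))))
        (Is31Profile-spokes k))
    where
    k : ℕ
    k = c₂ e₂
    col₂ : Fin (suc m₂) → ℕ
    col₂ = k ∷ c₂

corollary1 : {n₁ m₁ n₂ m₂ : ℕ} (G₁ : Graph n₁ m₁) (G₂ : Graph n₂ m₂) →
    Connected G₁ → FourRegular G₁ →
    Connected G₂ → FourRegular G₂ →
    ((Colorable31 G₁ × ¬ Colorable31 G₂) ⊎ (¬ Colorable31 G₁ × Colorable31 G₂)) →
    (e₁ : Fin m₁) (e₂ : Fin m₂) →
    Colorable31 (adhesion G₁ e₁ G₂ e₂)
corollary1 G₁ G₂ connected₁ regular₁ connected₂ regular₂ (inj₁ ((c₁ , coloring₁) , uncolourable₂)) e₁ e₂ =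
  Colorable31-adhesionˡ G₁ e₁ G₂ e₂ c₁ coloring₁ connected₂ regular₂
    (¬Colorable31⇒odd G₂ connected₂ regular₂ uncolourable₂ e₂)
corollary1 G₁ G₂ connected₁ regular₁ connected₂ regular₂ (inj₂ (uncolourable₁ , (c₂ , coloring₂))) e₁ e₂ =
  Colorable31-adhesionʳ G₁ e₁ G₂ e₂ connected₁ regular₁
    (¬Colorable31⇒odd G₁ connected₁ regular₁ uncolourable₁ e₁) c₂ coloring₂
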